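{- If $G$ is a graph, then $\rho^{\rm o}(S(G))=\alpha(G)+\alpha'(G)$.
   Context: An open packing in a graph is a set of vertices whose open neighborhoods are pairwise disjoint; $\rho^{\rm o}(H)$ is the maximum cardinality of an open packing of $H$. $\alpha(G)$ is the independence number of $G$ and $\alpha'(G)$ is the maximum cardinality of a matching of $G$. $S(G)$ is the subdivision of $G$, obtained by subdividing every edge of $G$ exactly once. -}

module Defs where

open import Data.Nat using (ℕ; _≤_)
open import Data.Bool using (Bool; T)
open import Data.Fin using (Fin; _<_)
open import Data.Product using (Σ; ∃; _×_; _,_; proj₁; proj₂; Σ-syntax; ∃-syntax)
open import Data.Sum using (_⊎_; inj₁; inj₂)
open import Data.Empty using (⊥)
open import Data.List using (List; length)
open import Data.List.Relation.Unary.AllPairs using (AllPairs)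
open import Relation.Nullary using (¬_)
open import Relation.Binary.PropositionalEquality using (_≡_; _≢_)

-- A finite simple graph on vertex set Fin n, with Boolean adjacency
-- (so adjacency proofs T (adj u v) are proof-irrelevant).
record Graph (n : ℕ) : Set where
  field
    adj    : Fin n → Fin n → Bool
    sym    : ∀ u v → adj u v ≡ adj v u
    irrefl : ∀ v → adj v v ≡ Data.Bool.false

open Graph public

record RawGraph : Set₁ where
  field
    Vtx : Set
    Adj : Vtx → Vtx → Set

open RawGraph public

toRaw : ∀ {n} → Graph n → RawGraph
toRaw {n} G = record { Vtx = Fin n ; Adj = λ u v → T (adj G u v) }

-- Edges of G: each edge {u,v} is represented once, as the pair (u , v) with u < v.
Edge : ∀ {n} → Graph n → Set
Edge {n} G = Σ[ u ∈ Fin n ] Σ[ v ∈ Fin n ] (u < v × T (adj G u v))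

_EndpointOf_ : ∀ {n} {G : Graph n} → Fin n → Edge G → Set
x EndpointOf (u , v , _) = (x ≡ u) ⊎ (x ≡ v)

SAdj : ∀ {n} (G : Graph n) → (Fin n ⊎ Edge G) → (Fin n ⊎ Edge G) → Set
SAdj G (inj₁ x) (inj₁ y) = ⊥
SAdj G (inj₁ x) (inj₂ e) = _EndpointOf_ {G = G} x e
SAdj G (inj₂ e) (inj₁ x) = _EndpointOf_ {G = G} x e
SAdj G (inj₂ e) (inj₂ f) = ⊥

S : ∀ {n} → Graph n → RawGraph
S G = record { Vtx = Fin _ ⊎ Edge G ; Adj = SAdj G }

-- Vertex sets are represented as duplicate-free lists; cardinality = length.
DupFree : ∀ {A : Set} → List A → Set
DupFree = AllPairs _≢_

IsOpenPacking : (H : RawGraph) → List (Vtx H) → Set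
IsOpenPacking H P =
  DupFree P × AllPairs (λ u v → ∀ w → ¬ (Adj H u w × Adj H v w)) P

IsIndependent : (H : RawGraph) → List (Vtx H) → Set
IsIndependent H P = DupFree P × AllPairs (λ u v → ¬ Adj H u v) P

REdge : RawGraph → Set
REdge H = Σ[ u ∈ Vtx H ] Σ[ v ∈ Vtx H ] Adj H u v

Disjoint : ∀ {H : RawGraph} → REdge H → REdge H → Set
Disjoint (a , b , _) (c , d , _) = a ≢ c × a ≢ d × b ≢ c × b ≢ d

IsMatching : (H : RawGraph) → List (REdge H) → Set
IsMatching H M = AllPairs (Disjoint {H}) M

IsMax : {A : Set} → (List A → Set) → ℕ → Set
IsMax P k = (∃[ xs ] (P xs × length xs ≡ k)) × (∀ xs → P xs → length xs ≤ k)

OpenPackingNumber IndependenceNumber : RawGraph → ℕ → Set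
OpenPackingNumber H = IsMax (IsOpenPacking H)
IndependenceNumber H = IsMax (IsIndependent H)

MatchingNumber : RawGraph → ℕ → Set
MatchingNumber H = IsMax (IsMatching H)

module Submission where

-- The vertices of S(G) are the vertices of G together with one subdivision
-- vertex per edge, and S(G) is bipartite between these two sides.  Hence in
-- S(G):
--   * a vertex of G and a subdivision vertex never have a common neighbour;
--   * distinct vertices x, y of G have a common neighbour iff xy ∈ E(G);
--   * distinct subdivision vertices e, f have a common neighbour iff the
--     edges e and f share an endpoint.
-- So a set of vertices of S(G) is an open packing exactly when its G-part is
-- independent in G and its edge-part is a matching of G, the two parts being
-- unconstrained with respect to each other.  Joining a maximum independent set
-- with a maximum matching gives ρᵒ(S(G)) ≥ α + α'; splitting an arbitrary
-- open packing into its two parts gives ρᵒ(S(G)) ≤ α + α'.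

open import Defs hiding (sym)
open import Data.Nat using (ℕ; suc; _+_; _≤_)
open import Data.Nat.Properties using (+-suc; +-mono-≤; module ≤-Reasoning)
open import Data.Bool using (T)
open import Data.Fin using (Fin)
open import Data.Fin.Properties using (<-cmp)
open import Data.Product using (_×_; _,_; proj₁)
open import Data.Sum using (_⊎_; inj₁; inj₂; swap)
open import Data.Sum.Properties using (inj₂-injective)
open import Data.Empty using (⊥-elim)
open import Data.List using (List; []; _∷_; length; map; _++_)
open import Data.List.Properties using (length-++; length-map)
open import Data.List.Relation.Unary.All as All using (All; []; _∷_)
import Data.List.Relation.Unary.All.Properties as All
open import Data.List.Relation.Unary.AllPairs as AllPairs using (AllPairs; []; _∷_)
import Data.List.Relation.Unary.AllPairs.Properties as AllPairs
open import Function using (_on_; _∘_)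
open import Level using (Level)
open import Relation.Nullary using (¬_)
open import Relation.Binary using (Rel; tri<; tri≈; tri>)
open import Relation.Binary.PropositionalEquality
  using (_≡_; _≢_; refl; sym; trans; subst; cong; cong₂)

module _ {A B : Set} where

  lefts : List (A ⊎ B) → List A
  lefts []            = []
  lefts (inj₁ x ∷ xs) = x ∷ lefts xs
  lefts (inj₂ _ ∷ xs) = lefts xs

  rights : List (A ⊎ B) → List B
  rights []            = []
  rights (inj₁ _ ∷ xs) = rights xs
  rights (inj₂ y ∷ xs) = y ∷ rights xs

  length-lefts+rights : ∀ xs → length xs ≡ length (lefts xs) + length (rights xs)
  length-lefts+rights []            = refl
  length-lefts+rights (inj₁ _ ∷ xs) = cong suc (length-lefts+rights xs)
  length-lefts+rights (inj₂ _ ∷ xs) = trans (cong suc (length-lefts+rights xs))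
    (sym (+-suc (length (lefts xs)) (length (rights xs))))

  module _ {p : Level} {P : A ⊎ B → Set p} where

    All-lefts : ∀ {xs} → All P xs → All (P ∘ inj₁) (lefts xs)
    All-lefts {[]}          []       = []
    All-lefts {inj₁ _ ∷ _} (px ∷ ps) = px ∷ All-lefts ps
    All-lefts {inj₂ _ ∷ _} (_  ∷ ps) = All-lefts ps

    All-rights : ∀ {xs} → All P xs → All (P ∘ inj₂) (rights xs)
    All-rights {[]}          []       = []
    All-rights {inj₁ _ ∷ _} (_  ∷ ps) = All-rights ps
    All-rights {inj₂ _ ∷ _} (px ∷ ps) = px ∷ All-rights ps

  module _ {r : Level} {R : Rel (A ⊎ B) r} where

    AllPairs-lefts : ∀ {xs} → AllPairs R xs → AllPairs (R on inj₁) (lefts xs)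
    AllPairs-lefts {[]}          []       = []
    AllPairs-lefts {inj₁ _ ∷ _} (px ∷ ps) = All-lefts px ∷ AllPairs-lefts ps
    AllPairs-lefts {inj₂ _ ∷ _} (_  ∷ ps) = AllPairs-lefts ps

    AllPairs-rights : ∀ {xs} → AllPairs R xs → AllPairs (R on inj₂) (rights xs)
    AllPairs-rights {[]}          []       = []
    AllPairs-rights {inj₁ _ ∷ _} (_  ∷ ps) = AllPairs-rights ps
    AllPairs-rights {inj₂ _ ∷ _} (px ∷ ps) = All-rights px ∷ AllPairs-rights ps

module _ {A B X : Set} (f : A → X) (g : B → X) where

  AllPairs-++-images : ∀ {r : Level} {R : Rel X r} {xs ys} → AllPairs (R on f) xs → AllPairs (R on g) ys →
                       (∀ x y → R (f x) (g y)) → AllPairs R (map f xs ++ map g ys)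
  AllPairs-++-images {xs = xs} {ys} Rxs Rys Rfg =
    AllPairs.++⁺ (AllPairs.map⁺ Rxs) (AllPairs.map⁺ Rys)
      (All.map⁺ (All.universal (λ x → All.map⁺ (All.universal (Rfg x) ys)) xs))

  length-++-images : ∀ xs ys → length (map f xs ++ map g ys) ≡ length xs + length ys
  length-++-images xs ys = trans (length-++ (map f xs))
    (cong₂ _+_ (length-map f xs) (length-map g ys))

module _ {n : ℕ} (G : Graph n) where

  _∈ₑ_ : Fin n → Edge G → Set
  _∈ₑ_ = _EndpointOf_ {G = G}

  Adjacent : Fin n → Fin n → Set
  Adjacent = Adj (toRaw G)

  endpoints-adjacent : ∀ {x y e} → x ≢ y → x ∈ₑ e → y ∈ₑ e → Adjacent x y
  endpoints-adjacent x≢y (inj₁ refl) (inj₁ refl) = ⊥-elim (x≢y refl)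
  endpoints-adjacent {e = _ , _ , _ , st} x≢y (inj₁ refl) (inj₂ refl) = st
  endpoints-adjacent {e = s , t , _ , st} x≢y (inj₂ refl) (inj₁ refl) =
    subst T (Graph.sym G s t) st
  endpoints-adjacent x≢y (inj₂ refl) (inj₂ refl) = ⊥-elim (x≢y refl)

  record EdgeThrough (x y : Fin n) : Set where
    field
      edge     : Edge G
      ends     : x ∈ₑ edge × y ∈ₑ edge
      onlyEnds : ∀ z → z ∈ₑ edge → z ≡ x ⊎ z ≡ y

  -- Every adjacency x ~ y is an edge: order the endpoints (x ≠ y by irreflexivity).
  edgeThrough : ∀ x y → Adjacent x y → EdgeThrough x y
  edgeThrough x y xy with <-cmp x y
  ... | tri< x<y _ _ = record
    { edge = x , y , x<y , xy ; ends = inj₁ refl , inj₂ refl ; onlyEnds = λ _ z∈ → z∈ }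
  ... | tri≈ _ refl _ = ⊥-elim (subst T (irrefl G x) xy)
  ... | tri> _ _ y<x = record
    { edge = y , x , y<x , subst T (Graph.sym G x y) xy
    ; ends = inj₂ refl , inj₁ refl ; onlyEnds = λ _ → swap }

  -- Matchings of G consist of adjacencies (x , y , x ~ y), while the
  -- subdivision vertices of S(G) are normalised edges; edgeOf and forget
  -- translate between the two.
  GEdge : Set
  GEdge = REdge (toRaw G)

  edgeOf : GEdge → Edge G
  edgeOf (x , y , xy) = EdgeThrough.edge (edgeThrough x y xy)

  forget : Edge G → GEdge
  forget (s , t , _ , st) = s , t , st

  sharedEnd⇒¬Disjoint : ∀ e f {z} → z ∈ₑ edgeOf e → z ∈ₑ edgeOf f → ¬ Disjoint {toRaw G} e f
  sharedEnd⇒¬Disjoint (x , y , xy) (u , v , uv) {z} z∈e z∈f (x≢u , x≢v , y≢u , y≢v)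
    with EdgeThrough.onlyEnds (edgeThrough x y xy) z z∈e
       | EdgeThrough.onlyEnds (edgeThrough u v uv) z z∈f
  ... | inj₁ refl | inj₁ refl = x≢u refl
  ... | inj₁ refl | inj₂ refl = x≢v refl
  ... | inj₂ refl | inj₁ refl = y≢u refl
  ... | inj₂ refl | inj₂ refl = y≢v refl

  VS : Set
  VS = Vtx (S G)

  Separated : VS → VS → Set
  Separated u v = u ≢ v × (∀ w → ¬ (SAdj G u w × SAdj G v w))

  openPacking⇒separated : ∀ {P} → IsOpenPacking (S G) P → AllPairs Separated P
  openPacking⇒separated = AllPairs.zip

  separated⇒openPacking : ∀ {P} → AllPairs Separated P → IsOpenPacking (S G) P
  separated⇒openPacking = AllPairs.unzip

  -- A vertex of G and a subdivision vertex are always separated (bipartiteness).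
  vertex-edge-separated : ∀ x e → Separated (inj₁ x) (inj₂ e)
  vertex-edge-separated x e = (λ ()) , λ { (inj₁ _) (() , _) ; (inj₂ _) (_ , ()) }

  NonAdjacent : Fin n → Fin n → Set
  NonAdjacent x y = x ≢ y × ¬ Adjacent x y

  nonAdjacent⇒separated : ∀ {x y} → NonAdjacent x y → Separated (inj₁ x) (inj₁ y)
  nonAdjacent⇒separated (x≢y , ¬xy) =
      (λ { refl → x≢y refl })
    , λ { (inj₁ _) (() , _) ; (inj₂ e) (x∈e , y∈e) → ¬xy (endpoints-adjacent {e = e} x≢y x∈e y∈e) }

  separated⇒nonAdjacent : ∀ {x y} → Separated (inj₁ x) (inj₁ y) → NonAdjacent x y
  separated⇒nonAdjacent {x} {y} (x≢y , noCommon) =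
      (λ { refl → x≢y refl })
    , λ xy → noCommon (inj₂ (EdgeThrough.edge (edgeThrough x y xy)))
                      (EdgeThrough.ends (edgeThrough x y xy))

  disjoint⇒separated : ∀ {e f} → Disjoint {toRaw G} e f →
                       Separated (inj₂ (edgeOf e)) (inj₂ (edgeOf f))
  disjoint⇒separated {e@(x , y , xy)} {f} e∩f=∅ =
      (λ e≡f → sharedEnd⇒¬Disjoint e f x∈e (subst (x ∈ₑ_) (inj₂-injective e≡f) x∈e) e∩f=∅)
    , λ { (inj₁ z) (z∈e , z∈f) → sharedEnd⇒¬Disjoint e f z∈e z∈f e∩f=∅ ; (inj₂ _) (() , _) }
    where x∈e = proj₁ (EdgeThrough.ends (edgeThrough x y xy))

  separated⇒disjoint : ∀ {e f} → Separated (inj₂ e) (inj₂ f) → Disjoint {toRaw G} (forget e) (forget f)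
  separated⇒disjoint (_ , noCommon) =
      (λ s≡s′ → noCommon (inj₁ _) (inj₁ refl , inj₁ s≡s′))
    , (λ s≡t′ → noCommon (inj₁ _) (inj₁ refl , inj₂ s≡t′))
    , (λ t≡s′ → noCommon (inj₁ _) (inj₂ refl , inj₁ t≡s′))
    , (λ t≡t′ → noCommon (inj₁ _) (inj₂ refl , inj₂ t≡t′))

  joinPacking : List (Fin n) → List GEdge → List VS
  joinPacking I M = map inj₁ I ++ map (inj₂ ∘ edgeOf) M

  joinPacking-isOpenPacking : ∀ {I M} → IsIndependent (toRaw G) I → IsMatching (toRaw G) M →
                              IsOpenPacking (S G) (joinPacking I M)
  joinPacking-isOpenPacking independent matching = separated⇒openPacking
    (AllPairs-++-images inj₁ (inj₂ ∘ edgeOf)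
      (AllPairs.map nonAdjacent⇒separated (AllPairs.zip independent))
      (AllPairs.map disjoint⇒separated matching)
      (λ x e → vertex-edge-separated x (edgeOf e)))

  openPacking-lefts : ∀ {P} → IsOpenPacking (S G) P → IsIndependent (toRaw G) (lefts P)
  openPacking-lefts packing = AllPairs.unzip
    (AllPairs.map separated⇒nonAdjacent (AllPairs-lefts (openPacking⇒separated packing)))

  openPacking-rights : ∀ {P} → IsOpenPacking (S G) P → IsMatching (toRaw G) (map forget (rights P))
  openPacking-rights packing = AllPairs.map⁺
    (AllPairs.map separated⇒disjoint (AllPairs-rights (openPacking⇒separated packing)))

mainTheorem2 : ∀ {n} (G : Graph n) (a a′ : ℕ)
    → IndependenceNumber (toRaw G) a
    → MatchingNumber (toRaw G) a′
    → OpenPackingNumber (S G) (a + a′)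
mainTheorem2 G a a′ ((I , independent , |I|≡a) , maxIndependent) ((M , matching , |M|≡a′) , maxMatching) =
    ( joinPacking G I M
    , joinPacking-isOpenPacking G independent matching
    , trans (length-++-images inj₁ (inj₂ ∘ edgeOf G) I M) (cong₂ _+_ |I|≡a |M|≡a′))
  , upperBound
  where
    open ≤-Reasoning
    upperBound : ∀ P → IsOpenPacking (S G) P → length P ≤ a + a′
    upperBound P packing = begin
      length P                                           ≡⟨ length-lefts+rights P ⟩
      length (lefts P) + length (rights P)               ≡⟨ cong (length (lefts P) +_)
                                                              (sym (length-map (forget G) (rights P))) ⟩
      length (lefts P) + length (map (forget G) (rights P))
        ≤⟨ +-mono-≤ (maxIndependent _ (openPacking-lefts G packing))
                    (maxMatching _ (openPacking-rights G packing)) ⟩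
      a + a′                                             ∎
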